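{- Let $\Gamma=(V,E)$ be a finite simple unweighted digraph of order $n$ that is not balanced. Then $\Gamma$ is a directed join of two balanced digraphs if and only if $n$ divides $\iota(i)-\iota(j)$ for all $i,j\in V$.
   Context: $\Gamma$ is balanced if every vertex has in-degree equal to out-degree. The imbalance of a vertex $i$ is $\iota(i)=d^+(i)-d^-(i)$ (out-degree minus in-degree). For $\Gamma_1=(V_1,E_1)$, $\Gamma_2=(V_2,E_2)$ with $V_1\cap V_2=\emptyset$, the directed join is $\Gamma_1\overset{\rightarrow}{\vee}\Gamma_2=(V_1\sqcup V_2,E_1\sqcup E_2\sqcup\{(i,j):i\in V_1,j\in V_2\})$; "$\Gamma$ is a directed join of two balanced digraphs" means $\Gamma$ equals (up to isomorphism) such a directed join with $\Gamma_1,\Gamma_2$ balanced. -}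

module Defs where

open import Data.Bool using (Bool; true; false; if_then_else_)
open import Data.Nat using (ℕ; _+_)
open import Data.Fin using (Fin; splitAt)
open import Data.List using (List; map; allFin)
open import Data.Nat.ListAction using (sum)
open import Data.Sum using (_⊎_; inj₁; inj₂)
open import Data.Product using (Σ; ∃; _×_)
open import Data.Integer using (ℤ; +_; _-_)
open import Function.Bundles using (_↔_; Inverse)
open import Relation.Binary.PropositionalEquality using (_≡_)
open import Relation.Nullary using (¬_)

-- A finite unweighted digraph on vertex set Fin n, given by its adjacency relation
-- (at most one arc (i,j) for each ordered pair, so no multiple arcs).
record Digraph (n : ℕ) : Set where
  constructor digraph
  field
    adj : Fin n → Fin n → Bool
open Digraph public

Loopless : ∀ {n} → Digraph n → Set
Loopless {n} Γ = ∀ (i : Fin n) → adj Γ i i ≡ false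

bit : Bool → ℕ
bit b = if b then 1 else 0

outdeg : ∀ {n} → Digraph n → Fin n → ℕ
outdeg {n} Γ i = sum (map (λ j → bit (adj Γ i j)) (allFin n))

indeg : ∀ {n} → Digraph n → Fin n → ℕ
indeg {n} Γ i = sum (map (λ j → bit (adj Γ j i)) (allFin n))

imbalance : ∀ {n} → Digraph n → Fin n → ℤ
imbalance Γ i = + outdeg Γ i - + indeg Γ i

Balanced : ∀ {n} → Digraph n → Set
Balanced {n} Γ = ∀ (i : Fin n) → outdeg Γ i ≡ indeg Γ i

-- directed join Γ₁ →∨ Γ₂ on Fin (a + b): first a vertices are V₁, last b are V₂;
-- all arcs from V₁ to V₂ are added.
joinAdj : ∀ {a b} → Digraph a → Digraph b → Fin (a + b) → Fin (a + b) → Bool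
joinAdj {a} Γ₁ Γ₂ x y with splitAt a x | splitAt a y
... | inj₁ i | inj₁ j = adj Γ₁ i j
... | inj₂ i | inj₂ j = adj Γ₂ i j
... | inj₁ i | inj₂ j = true
... | inj₂ i | inj₁ j = false

directedJoin : ∀ {a b} → Digraph a → Digraph b → Digraph (a + b)
directedJoin Γ₁ Γ₂ = digraph (joinAdj Γ₁ Γ₂)

_≅_ : ∀ {n m} → Digraph n → Digraph m → Set
_≅_ {n} {m} Γ Δ = Σ (Fin n ↔ Fin m) λ f →
  ∀ (i j : Fin n) → adj Γ i j ≡ adj Δ (Inverse.to f i) (Inverse.to f j)

IsDirectedJoinOfBalanced : ∀ {n} → Digraph n → Set
IsDirectedJoinOfBalanced Γ =
  ∃ λ a → ∃ λ b → Σ (Digraph a) λ Γ₁ → Σ (Digraph b) λ Γ₂ →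
    Balanced Γ₁ × Balanced Γ₂ × (Γ ≅ directedJoin Γ₁ Γ₂)

{-# OPTIONS --safe #-}

-- In a directed join Γ₁ →∨ Γ₂ of balanced digraphs of orders a and b, every vertex of Γ₁ has
-- imbalance b and every vertex of Γ₂ has imbalance −a, so imbalances differ by 0 or ±(a + b).
-- Conversely, in a loopless digraph every imbalance lies strictly between −n and n, so if n divides
-- all differences then the vertices of positive imbalance share one value e, the others share one
-- value −f, and e + f = n (both kinds occur since Γ is not balanced). Splitting the vertices into
-- these a and b vertices, the arcs from the first part minus those back number a e = b f ≤ a b;
-- with e + f = a + b this forces e = b, f = a, all arcs from the first part to the second and none
-- back, and then both parts are balanced.

module Submission where

open import Defs
open import Data.Nat using (ℕ)
open import Data.Fin using (Fin)
open import Data.Integer using (+_; _-_)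
open import Data.Integer.Divisibility using (_∣_)
open import Function.Bundles using (_⇔_)
open import Relation.Nullary using (¬_)

open import Data.Bool using (Bool; true; false)
open import Data.Empty using (⊥-elim)
open import Data.Fin using (zero; suc; _↑ˡ_; _↑ʳ_; join)
open import Data.Fin.Permutation using (↔⇒≡)
open import Data.Fin.Properties using (+↔⊎; splitAt-↑ˡ; splitAt-↑ʳ; any?)
open import Data.Integer as ℤ using (-_)
import Data.Integer.Properties as ℤ
open import Data.Integer.Tactic.RingSolver using (solve-∀)
open import Data.List using (map; allFin; tabulate)
open import Data.List.Properties using (map-tabulate; map-cong)
import Data.Nat.ListAction as List
open import Data.Nat using (zero; suc; _+_; _*_; _∸_; _≤_; _<_; z≤n; s≤s; _<?_; _≟_; ≢-nonZero)
open import Data.Nat.Divisibility using (divides; _∣0; ∣-refl; ∣⇒≤) renaming (_∣_ to _∣ℕ_)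
open import Data.Nat.Properties
open import Data.Product using (∃; ∃₂; Σ; _×_; _,_; proj₁; proj₂)
open import Data.Sum using (_⊎_; inj₁; inj₂)
open import Data.Sum.Algebra using (⊎-cong; ⊎-comm; ⊎-assoc)
open import Function using (_∘_)
open import Function.Bundles using (_↔_; Inverse; Equivalence; mk⇔)
open import Function.Properties.Inverse using (↔-refl; ↔-sym; ↔-trans)
open import Level using (0ℓ)
open import Relation.Binary.PropositionalEquality
open import Relation.Nullary using (yes; no)
open import Relation.Unary using (Decidable)

open import Algebra.Properties.CommutativeSemigroup +-commutativeSemigroup using (xy∙z≈xz∙y)
open import Algebra.Properties.CommutativeMonoid.Sum +-0-commutativeMonoid
  using (sum; sum-cong-≗; ∑-comm; ∑-distrib-+; sum-permute)

open Inverse using (to; from; strictlyInverseʳ; strictlyInverseˡ)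
open ≡-Reasoning

sum-tabulate : ∀ n (f : Fin n → ℕ) → List.sum (tabulate f) ≡ sum f
sum-tabulate zero    f = refl
sum-tabulate (suc n) f = cong (_+_ (f zero)) (sum-tabulate n (f ∘ suc))

sum-allFin : ∀ n (f : Fin n → ℕ) → List.sum (map f (allFin n)) ≡ sum f
sum-allFin n f = trans (cong List.sum (map-tabulate (λ i → i) f)) (sum-tabulate n f)

sum-const : ∀ n c → sum {n} (λ _ → c) ≡ n * c
sum-const zero    c = refl
sum-const (suc n) c = cong (_+_ c) (sum-const n c)

sum-ones : ∀ n → sum {n} (λ _ → 1) ≡ n
sum-ones n = trans (sum-const n 1) (*-identityʳ n)

sum-+-const : ∀ {k} {g h : Fin k → ℕ} c → (∀ i → g i ≡ h i + c) → sum g ≡ sum h + k * c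
sum-+-const {k} {g} {h} c g≡h+c =
  trans (sum-cong-≗ g≡h+c) (trans (∑-distrib-+ h (λ _ → c)) (cong (_+_ (sum h)) (sum-const k c)))

sum-↑ : ∀ a b (g : Fin (a + b) → ℕ) → sum g ≡ sum (g ∘ (_↑ˡ b)) + sum (g ∘ (a ↑ʳ_))
sum-↑ zero    b g = refl
sum-↑ (suc a) b g = trans (cong (_+_ (g zero)) (sum-↑ a b (g ∘ suc))) (sym (+-assoc (g zero) _ _))

sum-mono-≤ : ∀ {n} {f g : Fin n → ℕ} → (∀ i → f i ≤ g i) → sum f ≤ sum g
sum-mono-≤ {zero}  f≤g = z≤n
sum-mono-≤ {suc n} f≤g = +-mono-≤ (f≤g zero) (sum-mono-≤ (f≤g ∘ suc))

sum≡0⇒≗0 : ∀ {n} (f : Fin n → ℕ) → sum f ≡ 0 → ∀ i → f i ≡ 0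
sum≡0⇒≗0 {suc n} f Σf≡0 zero    = m+n≡0⇒m≡0 (f zero) Σf≡0
sum≡0⇒≗0 {suc n} f Σf≡0 (suc i) = sum≡0⇒≗0 (f ∘ suc) (m+n≡0⇒n≡0 (f zero) Σf≡0) i

≤∧sum≡⇒≗ : ∀ {n} {f g : Fin n → ℕ} → (∀ i → f i ≤ g i) → sum f ≡ sum g → ∀ i → f i ≡ g i
≤∧sum≡⇒≗ {f = f} {g} f≤g Σf≡Σg i =
  ≤-antisym (f≤g i) (m∸n≡0⇒m≤n (sum≡0⇒≗0 (λ j → g j ∸ f j) Σ[g∸f]≡0 i))
  where
  Σ[g∸f]≡0 : sum (λ j → g j ∸ f j) ≡ 0
  Σ[g∸f]≡0 = +-cancelˡ-≡ (sum f) _ 0 (begin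
    sum f + sum (λ j → g j ∸ f j)  ≡⟨ ∑-distrib-+ f _ ⟨
    sum (λ j → f j + (g j ∸ f j))  ≡⟨ sum-cong-≗ (λ j → m+[n∸m]≡n (f≤g j)) ⟩
    sum g                          ≡⟨ Σf≡Σg ⟨
    sum f                          ≡⟨ +-identityʳ (sum f) ⟨
    sum f + 0                      ∎)

bit≤1 : ∀ b → bit b ≤ 1
bit≤1 true  = s≤s z≤n
bit≤1 false = z≤n

sum-bit≤ : ∀ {n} (h : Fin n → Bool) → sum (bit ∘ h) ≤ n
sum-bit≤ {n} h = ≤-trans (sum-mono-≤ (bit≤1 ∘ h)) (≤-reflexive (sum-ones n))

sum-bit< : ∀ {n} (h : Fin n → Bool) i → h i ≡ false → sum (bit ∘ h) < n
sum-bit< {suc n} h zero    hi≡false rewrite hi≡false = s≤s (sum-bit≤ (h ∘ suc))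
sum-bit< {suc n} h (suc i) hi≡false =
  ≤-trans (≤-reflexive (sym (+-suc _ _))) (+-mono-≤ (bit≤1 (h zero)) (sum-bit< (h ∘ suc) i hi≡false))

sum-bit-true : ∀ {n} {h : Fin n → Bool} → (∀ i → h i ≡ true) → sum (bit ∘ h) ≡ n
sum-bit-true {n} h≡true = trans (sum-cong-≗ (cong bit ∘ h≡true)) (sum-ones n)

sum-bit-false : ∀ {n} {h : Fin n → Bool} → (∀ i → h i ≡ false) → sum (bit ∘ h) ≡ 0
sum-bit-false {n} h≡false = trans (sum-cong-≗ (cong bit ∘ h≡false)) (trans (sum-const n 0) (*-zeroʳ n))

sum-bit≡n⇒true : ∀ {n} (h : Fin n → Bool) → sum (bit ∘ h) ≡ n → ∀ i → h i ≡ true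
sum-bit≡n⇒true {n} h Σ≡n i = bit≡1⇒true (≤∧sum≡⇒≗ (bit≤1 ∘ h) (trans Σ≡n (sym (sum-ones n))) i)
  where
  bit≡1⇒true : ∀ {b} → bit b ≡ 1 → b ≡ true
  bit≡1⇒true {true} _ = refl

sum-bit≡0⇒false : ∀ {n} (h : Fin n → Bool) → sum (bit ∘ h) ≡ 0 → ∀ i → h i ≡ false
sum-bit≡0⇒false h Σ≡0 i = bit≡0⇒false (sum≡0⇒≗0 (bit ∘ h) Σ≡0 i)
  where
  bit≡0⇒false : ∀ {b} → bit b ≡ 0 → b ≡ false
  bit≡0⇒false {false} _ = refl

outdeg≡sum : ∀ {n} (Γ : Digraph n) i → outdeg Γ i ≡ sum (λ j → bit (adj Γ i j))
outdeg≡sum {n} Γ i = sum-allFin n _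

indeg≡sum : ∀ {n} (Γ : Digraph n) i → indeg Γ i ≡ sum (λ j → bit (adj Γ j i))
indeg≡sum {n} Γ i = sum-allFin n _

handshake : ∀ {n} (Γ : Digraph n) → sum (outdeg Γ) ≡ sum (indeg Γ)
handshake Γ = begin
  sum (outdeg Γ)                           ≡⟨ sum-cong-≗ (outdeg≡sum Γ) ⟩
  sum (λ i → sum (λ j → bit (adj Γ i j)))  ≡⟨ ∑-comm (λ i j → bit (adj Γ i j)) ⟩
  sum (λ j → sum (λ i → bit (adj Γ i j)))  ≡⟨ sum-cong-≗ (indeg≡sum Γ) ⟨
  sum (indeg Γ)                            ∎

outdeg<n : ∀ {n} (Γ : Digraph n) → Loopless Γ → ∀ i → outdeg Γ i < n
outdeg<n {n} Γ loopless i = subst (_< n) (sym (outdeg≡sum Γ i)) (sum-bit< (adj Γ i) i (loopless i))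

indeg<n : ∀ {n} (Γ : Digraph n) → Loopless Γ → ∀ i → indeg Γ i < n
indeg<n {n} Γ loopless i = subst (_< n) (sym (indeg≡sum Γ i)) (sum-bit< (λ j → adj Γ j i) i (loopless i))

Balanced-cong : ∀ {n} {Γ Δ : Digraph n} → (∀ i j → adj Γ i j ≡ adj Δ i j) → Balanced Δ → Balanced Γ
Balanced-cong {n} {Γ} {Δ} Γ≗Δ balanced i = begin
  outdeg Γ i  ≡⟨ cong List.sum (map-cong (λ j → cong bit (Γ≗Δ i j)) (allFin n)) ⟩
  outdeg Δ i  ≡⟨ balanced i ⟩
  indeg Δ i   ≡⟨ cong List.sum (map-cong (λ j → cong bit (Γ≗Δ j i)) (allFin n)) ⟨
  indeg Γ i   ∎

≤-indeg⇒Balanced : ∀ {n} (Γ : Digraph n) → (∀ i → outdeg Γ i ≤ indeg Γ i) → Balanced Γ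
≤-indeg⇒Balanced Γ out≤in = ≤∧sum≡⇒≗ out≤in (handshake Γ)

≤-outdeg⇒Balanced : ∀ {n} (Γ : Digraph n) → (∀ i → indeg Γ i ≤ outdeg Γ i) → Balanced Γ
≤-outdeg⇒Balanced Γ in≤out i = sym (≤∧sum≡⇒≗ in≤out (sym (handshake Γ)) i)

¬Balanced⇒∃excess : ∀ {n} (Γ : Digraph n) → ¬ Balanced Γ → ∃ λ i → indeg Γ i < outdeg Γ i
¬Balanced⇒∃excess Γ unbalanced with any? (λ i → indeg Γ i <? outdeg Γ i)
... | yes ∃excess = ∃excess
... | no  ∄excess = ⊥-elim (unbalanced (≤-indeg⇒Balanced Γ (λ i → ≮⇒≥ (λ lt → ∄excess (i , lt)))))

¬Balanced⇒∃deficit : ∀ {n} (Γ : Digraph n) → ¬ Balanced Γ → ∃ λ i → outdeg Γ i < indeg Γ i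
¬Balanced⇒∃deficit Γ unbalanced with any? (λ i → outdeg Γ i <? indeg Γ i)
... | yes ∃deficit = ∃deficit
... | no  ∄deficit = ⊥-elim (unbalanced (≤-outdeg⇒Balanced Γ (λ i → ≮⇒≥ (λ lt → ∄deficit (i , lt)))))

left : ∀ {n a b} → Fin n ↔ (Fin a ⊎ Fin b) → Fin a → Fin n
left σ u = from σ (inj₁ u)

right : ∀ {n a b} → Fin n ↔ (Fin a ⊎ Fin b) → Fin b → Fin n
right σ v = from σ (inj₂ v)

-- The left part of swap σ is the right part of σ, definitionally.
swap : ∀ {n a b} → Fin n ↔ (Fin a ⊎ Fin b) → Fin n ↔ (Fin b ⊎ Fin a)
swap σ = ↔-trans σ (⊎-comm _ _)

cons-left : ∀ {n a b} → Fin n ↔ (Fin a ⊎ Fin b) → Fin (suc n) ↔ (Fin (suc a) ⊎ Fin b)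
cons-left σ = ↔-trans +↔⊎ (↔-trans (⊎-cong ↔-refl σ)
  (↔-trans (↔-sym (⊎-assoc 0ℓ _ _ _)) (⊎-cong (↔-sym +↔⊎) ↔-refl)))

cons-right : ∀ {n a b} → Fin n ↔ (Fin a ⊎ Fin b) → Fin (suc n) ↔ (Fin a ⊎ Fin (suc b))
cons-right = swap ∘ cons-left ∘ swap

partition : ∀ {n} (P : Fin n → Set) → Decidable P →
  ∃₂ λ a b → Σ (Fin n ↔ (Fin a ⊎ Fin b)) λ σ → (∀ u → P (left σ u)) × (∀ v → ¬ P (right σ v))
partition {zero}  P P? = 0 , 0 , +↔⊎ , (λ ()) , (λ ())
partition {suc n} P P? with partition (P ∘ suc) (P? ∘ suc) | P? zero
... | a , b , σ , inside , outside | yes P0 =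
  suc a , b , cons-left σ , (λ { zero → P0 ; (suc u) → inside u }) , outside
... | a , b , σ , inside , outside | no ¬P0 =
  a , suc b , cons-right σ , inside , (λ { zero → ¬P0 ; (suc v) → outside v })

sum-⊎ : ∀ {n a b} (σ : Fin n ↔ (Fin a ⊎ Fin b)) (g : Fin n → ℕ) →
  sum g ≡ sum (g ∘ left σ) + sum (g ∘ right σ)
sum-⊎ {a = a} {b} σ g = begin
  sum g                                                 ≡⟨ sum-permute g π ⟩
  sum (g ∘ to π)                                        ≡⟨ sum-↑ a b (g ∘ to π) ⟩
  sum (g ∘ to π ∘ (_↑ˡ b)) + sum (g ∘ to π ∘ (a ↑ʳ_))  ≡⟨ cong₂ _+_
    (sum-cong-≗ (λ u → cong (g ∘ from σ) (splitAt-↑ˡ a u b)))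
    (sum-cong-≗ (λ v → cong (g ∘ from σ) (splitAt-↑ʳ a b v))) ⟩
  sum (g ∘ left σ) + sum (g ∘ right σ)                  ∎
  where
  π = ↔-trans +↔⊎ (↔-sym σ)

induced : ∀ {k n} → (Fin k → Fin n) → Digraph n → Digraph k
induced S Γ = digraph (λ s s′ → adj Γ (S s) (S s′))

arcs : ∀ {n k l} → Digraph n → (Fin k → Fin n) → (Fin l → Fin n) → ℕ
arcs Γ S T = sum (λ s → sum (λ t → bit (adj Γ (S s) (T t))))

arcs≤ : ∀ {n k l} (Γ : Digraph n) (S : Fin k → Fin n) (T : Fin l → Fin n) → arcs Γ S T ≤ k * l
arcs≤ {k = k} {l} Γ S T =
  ≤-trans (sum-mono-≤ (λ s → sum-bit≤ (λ t → adj Γ (S s) (T t)))) (≤-reflexive (sum-const k l))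

arcs≡*⇒complete : ∀ {n k l} (Γ : Digraph n) (S : Fin k → Fin n) (T : Fin l → Fin n) →
  arcs Γ S T ≡ k * l → ∀ s t → adj Γ (S s) (T t) ≡ true
arcs≡*⇒complete {k = k} {l} Γ S T arcs≡kl s =
  sum-bit≡n⇒true _
    (≤∧sum≡⇒≗ (λ s → sum-bit≤ (λ t → adj Γ (S s) (T t))) (trans arcs≡kl (sym (sum-const k l))) s)

arcs≡0⇒empty : ∀ {n k l} (Γ : Digraph n) (S : Fin k → Fin n) (T : Fin l → Fin n) →
  arcs Γ S T ≡ 0 → ∀ s t → adj Γ (S s) (T t) ≡ false
arcs≡0⇒empty Γ S T arcs≡0 s = sum-bit≡0⇒false _ (sum≡0⇒≗0 _ arcs≡0 s)

module _ {n a b} (Γ : Digraph n) (σ : Fin n ↔ (Fin a ⊎ Fin b)) where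

  private
    L = left σ
    R = right σ
    Γ[L] = induced L Γ

  outdeg-left : ∀ u → outdeg Γ (L u) ≡ outdeg Γ[L] u + sum (λ v → bit (adj Γ (L u) (R v)))
  outdeg-left u = trans (outdeg≡sum Γ (L u))
    (trans (sum-⊎ σ _) (cong (_+ sum (λ v → bit (adj Γ (L u) (R v)))) (sym (outdeg≡sum Γ[L] u))))

  indeg-left : ∀ u → indeg Γ (L u) ≡ indeg Γ[L] u + sum (λ v → bit (adj Γ (R v) (L u)))
  indeg-left u = trans (indeg≡sum Γ (L u))
    (trans (sum-⊎ σ _) (cong (_+ sum (λ v → bit (adj Γ (R v) (L u)))) (sym (indeg≡sum Γ[L] u))))

  -- Arcs inside the left part contribute equally to both sides, by the handshake lemma.
  sum-outdeg-left : sum (outdeg Γ ∘ L) + arcs Γ R L ≡ sum (indeg Γ ∘ L) + arcs Γ L R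
  sum-outdeg-left = begin
    sum (outdeg Γ ∘ L) + arcs Γ R L                ≡⟨ cong (_+ arcs Γ R L) Σoutdeg-left ⟩
    (sum (outdeg Γ[L]) + arcs Γ L R) + arcs Γ R L  ≡⟨ cong (λ x → x + arcs Γ L R + arcs Γ R L) (handshake Γ[L]) ⟩
    (sum (indeg Γ[L]) + arcs Γ L R) + arcs Γ R L   ≡⟨ xy∙z≈xz∙y (sum (indeg Γ[L])) _ _ ⟩
    (sum (indeg Γ[L]) + arcs Γ R L) + arcs Γ L R   ≡⟨ cong (_+ arcs Γ L R) Σindeg-left ⟨
    sum (indeg Γ ∘ L) + arcs Γ L R                 ∎
    where
    Σoutdeg-left : sum (outdeg Γ ∘ L) ≡ sum (outdeg Γ[L]) + arcs Γ L R
    Σoutdeg-left = trans (sum-cong-≗ outdeg-left) (∑-distrib-+ (outdeg Γ[L]) _)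
    Σindeg-left : sum (indeg Γ ∘ L) ≡ sum (indeg Γ[L]) + arcs Γ R L
    Σindeg-left = trans (sum-cong-≗ indeg-left)
      (trans (∑-distrib-+ (indeg Γ[L]) _) (cong (_+_ (sum (indeg Γ[L]))) (∑-comm (λ u v → bit (adj Γ (R v) (L u))))))

IsJoinSplitting : ∀ {n a b} → Digraph n → Fin n ↔ (Fin a ⊎ Fin b) → Set
IsJoinSplitting Γ σ =
  (∀ u v → adj Γ (left σ u) (right σ v) ≡ true) × (∀ u v → adj Γ (right σ v) (left σ u) ≡ false)

module _ {n a b} (Γ : Digraph n) (σ : Fin n ↔ (Fin a ⊎ Fin b)) (isJoin : IsJoinSplitting Γ σ) where

  left-balanced⇔ : Balanced (induced (left σ) Γ) ⇔ (∀ u → outdeg Γ (left σ u) ≡ indeg Γ (left σ u) + b)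
  left-balanced⇔ = mk⇔
    (λ balanced u → trans out≡ (cong (_+ b) (trans (balanced u) (sym in≡))))
    (λ excess u → +-cancelʳ-≡ b _ _ (trans (sym out≡) (trans (excess u) (cong (_+ b) in≡))))
    where
    out≡ : ∀ {u} → outdeg Γ (left σ u) ≡ outdeg (induced (left σ) Γ) u + b
    out≡ {u} = trans (outdeg-left Γ σ u) (cong (_+_ _) (sum-bit-true (proj₁ isJoin u)))
    in≡ : ∀ {u} → indeg Γ (left σ u) ≡ indeg (induced (left σ) Γ) u
    in≡ {u} = trans (indeg-left Γ σ u)
      (trans (cong (_+_ _) (sum-bit-false (λ v → proj₂ isJoin u v))) (+-identityʳ _))

  right-balanced⇔ : Balanced (induced (right σ) Γ) ⇔ (∀ v → indeg Γ (right σ v) ≡ outdeg Γ (right σ v) + a)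
  right-balanced⇔ = mk⇔
    (λ balanced v → trans in≡ (cong (_+ a) (trans (sym (balanced v)) (sym out≡))))
    (λ deficit v → sym (+-cancelʳ-≡ a _ _ (trans (sym in≡) (trans (deficit v) (cong (_+ a) out≡)))))
    where
    out≡ : ∀ {v} → outdeg Γ (right σ v) ≡ outdeg (induced (right σ) Γ) v
    out≡ {v} = trans (outdeg-left Γ (swap σ) v)
      (trans (cong (_+_ _) (sum-bit-false (λ u → proj₂ isJoin u v))) (+-identityʳ _))
    in≡ : ∀ {v} → indeg Γ (right σ v) ≡ indeg (induced (right σ) Γ) v + a
    in≡ {v} = trans (indeg-left Γ (swap σ) v) (cong (_+_ _) (sum-bit-true (λ u → proj₁ isJoin u v)))

module _ {a b} (Γ₁ : Digraph a) (Γ₂ : Digraph b) where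

  joinAdj-↑ˡ-↑ˡ : ∀ u u′ → joinAdj Γ₁ Γ₂ (u ↑ˡ b) (u′ ↑ˡ b) ≡ adj Γ₁ u u′
  joinAdj-↑ˡ-↑ˡ u u′ rewrite splitAt-↑ˡ a u b | splitAt-↑ˡ a u′ b = refl

  joinAdj-↑ˡ-↑ʳ : ∀ u v → joinAdj Γ₁ Γ₂ (u ↑ˡ b) (a ↑ʳ v) ≡ true
  joinAdj-↑ˡ-↑ʳ u v rewrite splitAt-↑ˡ a u b | splitAt-↑ʳ a b v = refl

  joinAdj-↑ʳ-↑ˡ : ∀ v u → joinAdj Γ₁ Γ₂ (a ↑ʳ v) (u ↑ˡ b) ≡ false
  joinAdj-↑ʳ-↑ˡ v u rewrite splitAt-↑ʳ a b v | splitAt-↑ˡ a u b = refl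

  joinAdj-↑ʳ-↑ʳ : ∀ v v′ → joinAdj Γ₁ Γ₂ (a ↑ʳ v) (a ↑ʳ v′) ≡ adj Γ₂ v v′
  joinAdj-↑ʳ-↑ʳ v v′ rewrite splitAt-↑ʳ a b v | splitAt-↑ʳ a b v′ = refl

adj-from : ∀ {n m} {Γ : Digraph n} (Δ : Digraph m) (iso : Γ ≅ Δ) →
  ∀ x y → adj Γ (from (proj₁ iso) x) (from (proj₁ iso) y) ≡ adj Δ x y
adj-from Δ (f , adj≡) x y =
  trans (adj≡ (from f x) (from f y)) (cong₂ (adj Δ) (strictlyInverseˡ f x) (strictlyInverseˡ f y))

IsJoinSplitting⇒≅ : ∀ {n a b} (Γ : Digraph n) (σ : Fin n ↔ (Fin a ⊎ Fin b)) → IsJoinSplitting Γ σ →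
  Γ ≅ directedJoin (induced (left σ) Γ) (induced (right σ) Γ)
IsJoinSplitting⇒≅ {a = a} {b} Γ σ (complete , empty) = ↔-trans σ (↔-sym +↔⊎) , adj≡
  where
  Γ₁ = induced (left σ) Γ
  Γ₂ = induced (right σ) Γ
  adj-via-σ : ∀ x y → adj Γ (from σ x) (from σ y) ≡ joinAdj Γ₁ Γ₂ (join a b x) (join a b y)
  adj-via-σ (inj₁ u) (inj₁ u′) = sym (joinAdj-↑ˡ-↑ˡ Γ₁ Γ₂ u u′)
  adj-via-σ (inj₁ u) (inj₂ v)  = trans (complete u v) (sym (joinAdj-↑ˡ-↑ʳ Γ₁ Γ₂ u v))
  adj-via-σ (inj₂ v) (inj₁ u)  = trans (empty u v) (sym (joinAdj-↑ʳ-↑ˡ Γ₁ Γ₂ v u))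
  adj-via-σ (inj₂ v) (inj₂ v′) = sym (joinAdj-↑ʳ-↑ʳ Γ₁ Γ₂ v v′)
  adj≡ : ∀ i j → adj Γ i j ≡ joinAdj Γ₁ Γ₂ (join a b (to σ i)) (join a b (to σ j))
  adj≡ i j =
    trans (sym (cong₂ (adj Γ) (strictlyInverseʳ σ i) (strictlyInverseʳ σ j))) (adj-via-σ (to σ i) (to σ j))

elim-left-right : ∀ {n a b} (σ : Fin n ↔ (Fin a ⊎ Fin b)) (P : Fin n → Set) →
  (∀ u → P (left σ u)) → (∀ v → P (right σ v)) → ∀ i → P i
elim-left-right σ P Pˡ Pʳ i = subst P (strictlyInverseʳ σ i) (P-from (to σ i))
  where
  P-from : ∀ x → P (from σ x)
  P-from (inj₁ u) = Pˡ u
  P-from (inj₂ v) = Pʳ v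

imbalance≡+ : ∀ {n} (Γ : Digraph n) {i k} → outdeg Γ i ≡ indeg Γ i + k → imbalance Γ i ≡ + k
imbalance≡+ Γ {i} {k} out≡in+k = begin
  + outdeg Γ i - + indeg Γ i           ≡⟨ cong (λ o → + o - + indeg Γ i) out≡in+k ⟩
  + (indeg Γ i + k) - + indeg Γ i      ≡⟨ cong (_- + indeg Γ i) (ℤ.pos-+ (indeg Γ i) k) ⟩
  (+ indeg Γ i ℤ.+ + k) - + indeg Γ i  ≡⟨ [x+y]-x≡y (+ indeg Γ i) (+ k) ⟩
  + k                                  ∎
  where
  [x+y]-x≡y : ∀ x y → (x ℤ.+ y) - x ≡ y
  [x+y]-x≡y = solve-∀

imbalance≡- : ∀ {n} (Γ : Digraph n) {i k} → indeg Γ i ≡ outdeg Γ i + k → imbalance Γ i ≡ - + k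
imbalance≡- Γ {i} {k} in≡out+k = begin
  + outdeg Γ i - + indeg Γ i            ≡⟨ cong (λ d → + outdeg Γ i - + d) in≡out+k ⟩
  + outdeg Γ i - + (outdeg Γ i + k)     ≡⟨ cong (λ d → + outdeg Γ i - d) (ℤ.pos-+ (outdeg Γ i) k) ⟩
  + outdeg Γ i - (+ outdeg Γ i ℤ.+ + k) ≡⟨ x-[x+y]≡-y (+ outdeg Γ i) (+ k) ⟩
  - + k                                 ∎
  where
  x-[x+y]≡-y : ∀ x y → x - (x ℤ.+ y) ≡ - y
  x-[x+y]≡-y = solve-∀

ImbalancesCongruent : ∀ {n} → Digraph n → Set
ImbalancesCongruent {n} Γ = ∀ i j → + n ∣ imbalance Γ i - imbalance Γ j

+m--+n≡+[m+n] : ∀ m n → + m - - + n ≡ + (m + n)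
+m--+n≡+[m+n] m n = trans (cong (ℤ._+_ (+ m)) (ℤ.neg-involutive (+ n))) (sym (ℤ.pos-+ m n))

∣+b--+a∣≡a+b : ∀ a b → ℤ.∣ + b - - + a ∣ ≡ a + b
∣+b--+a∣≡a+b a b = trans (cong ℤ.∣_∣ (+m--+n≡+[m+n] b a)) (+-comm b a)

+[a+b]∣differences-of-+b-and--a : ∀ a b {x y} →
  x ≡ + b ⊎ x ≡ - + a → y ≡ + b ⊎ y ≡ - + a → + (a + b) ∣ x - y
+[a+b]∣differences-of-+b-and--a a b {x} (inj₁ refl) (inj₁ refl) =
  subst (+ (a + b) ∣_) (sym (ℤ.+-inverseʳ x)) ((a + b) ∣0)
+[a+b]∣differences-of-+b-and--a a b {x} (inj₂ refl) (inj₂ refl) =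
  subst (+ (a + b) ∣_) (sym (ℤ.+-inverseʳ x)) ((a + b) ∣0)
+[a+b]∣differences-of-+b-and--a a b (inj₁ refl) (inj₂ refl) =
  subst ((a + b) ∣ℕ_) (sym (∣+b--+a∣≡a+b a b)) ∣-refl
+[a+b]∣differences-of-+b-and--a a b (inj₂ refl) (inj₁ refl) =
  subst ((a + b) ∣ℕ_) (sym (trans (ℤ.∣i-j∣≡∣j-i∣ (- + a) (+ b)) (∣+b--+a∣≡a+b a b))) ∣-refl

IsDirectedJoinOfBalanced⇒ImbalancesCongruent : ∀ {n} (Γ : Digraph n) →
  IsDirectedJoinOfBalanced Γ → ImbalancesCongruent Γ
IsDirectedJoinOfBalanced⇒ImbalancesCongruent {n} Γ (a , b , Γ₁ , Γ₂ , balanced₁ , balanced₂ , f) i j =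
  subst (λ d → + d ∣ imbalance Γ i - imbalance Γ j) (sym (↔⇒≡ (proj₁ f)))
    (+[a+b]∣differences-of-+b-and--a a b (two-valued i) (two-valued j))
  where
  σ = ↔-trans (proj₁ f) +↔⊎
  adj≡joinAdj : ∀ x y → adj Γ (from (proj₁ f) x) (from (proj₁ f) y) ≡ joinAdj Γ₁ Γ₂ x y
  adj≡joinAdj = adj-from (directedJoin Γ₁ Γ₂) f
  isJoin : IsJoinSplitting Γ σ
  isJoin = (λ u v → trans (adj≡joinAdj (u ↑ˡ b) (a ↑ʳ v)) (joinAdj-↑ˡ-↑ʳ Γ₁ Γ₂ u v))
         , (λ u v → trans (adj≡joinAdj (a ↑ʳ v) (u ↑ˡ b)) (joinAdj-↑ʳ-↑ˡ Γ₁ Γ₂ v u))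
  left-excess : ∀ u → outdeg Γ (left σ u) ≡ indeg Γ (left σ u) + b
  left-excess = Equivalence.to (left-balanced⇔ Γ σ isJoin)
    (Balanced-cong (λ u u′ → trans (adj≡joinAdj (u ↑ˡ b) (u′ ↑ˡ b)) (joinAdj-↑ˡ-↑ˡ Γ₁ Γ₂ u u′)) balanced₁)
  right-deficit : ∀ v → indeg Γ (right σ v) ≡ outdeg Γ (right σ v) + a
  right-deficit = Equivalence.to (right-balanced⇔ Γ σ isJoin)
    (Balanced-cong (λ v v′ → trans (adj≡joinAdj (a ↑ʳ v) (a ↑ʳ v′)) (joinAdj-↑ʳ-↑ʳ Γ₁ Γ₂ v v′)) balanced₂)
  two-valued : ∀ i → imbalance Γ i ≡ + b ⊎ imbalance Γ i ≡ - + a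
  two-valued = elim-left-right σ _ (inj₁ ∘ imbalance≡+ Γ ∘ left-excess) (inj₂ ∘ imbalance≡- Γ ∘ right-deficit)

m∣n∧n<m⇒n≡0 : ∀ {m n} → m ∣ℕ n → n < m → n ≡ 0
m∣n∧n<m⇒n≡0 {n = zero}  _   _   = refl
m∣n∧n<m⇒n≡0 {n = suc n} m∣n n<m = ⊥-elim (<⇒≱ n<m (∣⇒≤ m∣n))

m∣n∧0<n<m+m⇒n≡m : ∀ {m n} → m ∣ℕ n → 0 < n → n < m + m → n ≡ m
m∣n∧0<n<m+m⇒n≡m     (divides zero          n≡0)  0<n _      = ⊥-elim (<⇒≢ 0<n (sym n≡0))
m∣n∧0<n<m+m⇒n≡m {m} (divides (suc zero)    n≡m+0) _  _     = trans n≡m+0 (+-identityʳ m)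
m∣n∧0<n<m+m⇒n≡m {m} (divides (suc (suc q)) n≡m+m+qm) _ n<m+m =
  ⊥-elim (<⇒≱ n<m+m (≤-trans (+-monoʳ-≤ m (m≤m+n m (q * m))) (≤-reflexive (sym n≡m+m+qm))))

+d∣+m-+n⇒m≡n : ∀ {d m n} → + d ∣ + m - + n → m < d → n < d → m ≡ n
+d∣+m-+n⇒m≡n {d} {m} {n} d∣m-n m<d n<d =
  ℤ.+-injective (ℤ.i-j≡0⇒i≡j (+ m) (+ n) (ℤ.∣i∣≡0⇒i≡0 (m∣n∧n<m⇒n≡0 d∣m-n ∣m-n∣<d)))
  where
  ∣m-n∣<d : ℤ.∣ + m - + n ∣ < d
  ∣m-n∣<d = ≤-<-trans (≤-reflexive (cong ℤ.∣_∣ (ℤ.m-n≡m⊖n m n)))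
              (≤-<-trans (ℤ.∣m⊝n∣≤m⊔n m n) (⊔-pres-<m m<d n<d))

+d∣+m--+n⇒m+n≡d : ∀ {d m n} → + d ∣ + m - - + n → 0 < m → m < d → n < d → m + n ≡ d
+d∣+m--+n⇒m+n≡d {d} {m} {n} d∣m+n 0<m m<d n<d =
  m∣n∧0<n<m+m⇒n≡m (subst (λ k → d ∣ℕ ℤ.∣ k ∣) (+m--+n≡+[m+n] m n) d∣m+n)
    (≤-trans 0<m (m≤m+n m n)) (+-mono-< m<d n<d)

excess : ∀ {n} → Digraph n → Fin n → ℕ
excess Γ i = outdeg Γ i ∸ indeg Γ i

deficit : ∀ {n} → Digraph n → Fin n → ℕ
deficit Γ i = indeg Γ i ∸ outdeg Γ i

outdeg≡indeg+excess : ∀ {n} (Γ : Digraph n) {i} → indeg Γ i ≤ outdeg Γ i → outdeg Γ i ≡ indeg Γ i + excess Γ i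
outdeg≡indeg+excess Γ in≤out = sym (m+[n∸m]≡n in≤out)

indeg≡outdeg+deficit : ∀ {n} (Γ : Digraph n) {i} → outdeg Γ i ≤ indeg Γ i → indeg Γ i ≡ outdeg Γ i + deficit Γ i
indeg≡outdeg+deficit Γ out≤in = sym (m+[n∸m]≡n out≤in)

module _ {n} (Γ : Digraph n) (loopless : Loopless Γ) (congruent : ImbalancesCongruent Γ) where

  private
    excess<n : ∀ i → excess Γ i < n
    excess<n i = ≤-<-trans (m∸n≤m (outdeg Γ i) (indeg Γ i)) (outdeg<n Γ loopless i)

    deficit<n : ∀ i → deficit Γ i < n
    deficit<n i = ≤-<-trans (m∸n≤m (indeg Γ i) (outdeg Γ i)) (indeg<n Γ loopless i)

    imbalance≡+excess : ∀ {i} → indeg Γ i ≤ outdeg Γ i → imbalance Γ i ≡ + excess Γ i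
    imbalance≡+excess = imbalance≡+ Γ ∘ outdeg≡indeg+excess Γ

    imbalance≡-deficit : ∀ {i} → outdeg Γ i ≤ indeg Γ i → imbalance Γ i ≡ - + deficit Γ i
    imbalance≡-deficit = imbalance≡- Γ ∘ indeg≡outdeg+deficit Γ

  excess-unique : ∀ {i j} → indeg Γ i ≤ outdeg Γ i → indeg Γ j ≤ outdeg Γ j → excess Γ i ≡ excess Γ j
  excess-unique {i} {j} in≤outᵢ in≤outⱼ = +d∣+m-+n⇒m≡n
    (subst₂ (λ x y → + n ∣ x - y) (imbalance≡+excess in≤outᵢ) (imbalance≡+excess in≤outⱼ) (congruent i j))
    (excess<n i) (excess<n j)

  deficit-unique : ∀ {i j} → outdeg Γ i ≤ indeg Γ i → outdeg Γ j ≤ indeg Γ j → deficit Γ i ≡ deficit Γ j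
  deficit-unique {i} {j} out≤inᵢ out≤inⱼ = +d∣+m-+n⇒m≡n
    (subst (+ n ∣_) (-y--x≡x-y (+ deficit Γ i) (+ deficit Γ j))
      (subst₂ (λ x y → + n ∣ x - y) (imbalance≡-deficit out≤inⱼ) (imbalance≡-deficit out≤inᵢ) (congruent j i)))
    (deficit<n i) (deficit<n j)
    where
    -y--x≡x-y : ∀ x y → - y - - x ≡ x - y
    -y--x≡x-y = solve-∀

  excess+deficit≡n : ∀ {i j} → indeg Γ i < outdeg Γ i → outdeg Γ j ≤ indeg Γ j → excess Γ i + deficit Γ j ≡ n
  excess+deficit≡n {i} {j} in<outᵢ out≤inⱼ = +d∣+m--+n⇒m+n≡d
    (subst₂ (λ x y → + n ∣ x - y) (imbalance≡+excess (<⇒≤ in<outᵢ)) (imbalance≡-deficit out≤inⱼ) (congruent i j))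
    (m<n⇒0<n∸m in<outᵢ) (excess<n i) (deficit<n j)

m+n≤m⇒n≡0 : ∀ m {n} → m + n ≤ m → n ≡ 0
m+n≤m⇒n≡0 m {n} m+n≤m = n≤0⇒n≡0 (+-cancelˡ-≤ m n 0 (subst (m + n ≤_) (sym (+-identityʳ m)) m+n≤m))

m*o≡n*p∧o+p≡m+n⇒o≡n : ∀ m n o p → m * o ≡ n * p → o + p ≡ m + n → o ≡ n
m*o≡n*p∧o+p≡m+n⇒o≡n m n o p mo≡np o+p≡m+n with m + n ≟ 0
... | yes m+n≡0 = trans (m+n≡0⇒m≡0 o (trans o+p≡m+n m+n≡0)) (sym (m+n≡0⇒n≡0 m m+n≡0))
... | no  m+n≢0 = *-cancelˡ-≡ o n (m + n) {{≢-nonZero m+n≢0}} (begin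
  (m + n) * o    ≡⟨ *-distribʳ-+ o m n ⟩
  m * o + n * o  ≡⟨ cong (_+ n * o) mo≡np ⟩
  n * p + n * o  ≡⟨ *-distribˡ-+ n p o ⟨
  n * (p + o)    ≡⟨ cong (n *_) (trans (+-comm p o) o+p≡m+n) ⟩
  n * (m + n)    ≡⟨ *-comm n (m + n) ⟩
  (m + n) * n    ∎)

-- Both a * e and b * f count the arcs from left to right minus those back, and at most a * b
-- arcs go from left to right.
module ExcessSplitting {n a b e f} (Γ : Digraph n) (σ : Fin n ↔ (Fin a ⊎ Fin b))
  (left-excess : ∀ u → outdeg Γ (left σ u) ≡ indeg Γ (left σ u) + e)
  (right-deficit : ∀ v → indeg Γ (right σ v) ≡ outdeg Γ (right σ v) + f)
  (e+f≡n : e + f ≡ n) where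

  private
    L = left σ
    R = right σ

  arcs-out-of-left : arcs Γ L R ≡ a * e + arcs Γ R L
  arcs-out-of-left = +-cancelˡ-≡ (sum (indeg Γ ∘ L)) _ _ (begin
    sum (indeg Γ ∘ L) + arcs Γ L R            ≡⟨ sum-outdeg-left Γ σ ⟨
    sum (outdeg Γ ∘ L) + arcs Γ R L           ≡⟨ cong (_+ arcs Γ R L) (sum-+-const e left-excess) ⟩
    (sum (indeg Γ ∘ L) + a * e) + arcs Γ R L  ≡⟨ +-assoc (sum (indeg Γ ∘ L)) _ _ ⟩
    sum (indeg Γ ∘ L) + (a * e + arcs Γ R L)  ∎)

  arcs-into-right : arcs Γ L R ≡ b * f + arcs Γ R L
  arcs-into-right = +-cancelˡ-≡ (sum (outdeg Γ ∘ R)) _ _ (begin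
    sum (outdeg Γ ∘ R) + arcs Γ L R            ≡⟨ sum-outdeg-left Γ (swap σ) ⟩
    sum (indeg Γ ∘ R) + arcs Γ R L             ≡⟨ cong (_+ arcs Γ R L) (sum-+-const f right-deficit) ⟩
    (sum (outdeg Γ ∘ R) + b * f) + arcs Γ R L  ≡⟨ +-assoc (sum (outdeg Γ ∘ R)) _ _ ⟩
    sum (outdeg Γ ∘ R) + (b * f + arcs Γ R L)  ∎)

  n≡a+b : n ≡ a + b
  n≡a+b = ↔⇒≡ (↔-trans σ (↔-sym +↔⊎))

  e≡b : e ≡ b
  e≡b = m*o≡n*p∧o+p≡m+n⇒o≡n a b e f
    (+-cancelʳ-≡ (arcs Γ R L) _ _ (trans (sym arcs-out-of-left) arcs-into-right))
    (trans e+f≡n n≡a+b)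

  f≡a : f ≡ a
  f≡a = +-cancelˡ-≡ b f a (trans (cong (_+ f) (sym e≡b)) (trans e+f≡n (trans n≡a+b (+-comm a b))))

  no-arcs-into-left : arcs Γ R L ≡ 0
  no-arcs-into-left = m+n≤m⇒n≡0 (a * b)
    (subst (_≤ a * b) (trans arcs-out-of-left (cong (λ k → a * k + arcs Γ R L) e≡b)) (arcs≤ Γ L R))

  isJoinSplitting : IsJoinSplitting Γ σ
  isJoinSplitting =
    arcs≡*⇒complete Γ L R arcs-out-of-left≡a*b , λ u v → arcs≡0⇒empty Γ R L no-arcs-into-left v u
    where
    arcs-out-of-left≡a*b : arcs Γ L R ≡ a * b
    arcs-out-of-left≡a*b =
      trans arcs-out-of-left (trans (cong₂ _+_ (cong (a *_) e≡b) no-arcs-into-left) (+-identityʳ (a * b)))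

  left-balanced : Balanced (induced L Γ)
  left-balanced = Equivalence.from (left-balanced⇔ Γ σ isJoinSplitting)
    (λ u → subst (λ k → outdeg Γ (L u) ≡ indeg Γ (L u) + k) e≡b (left-excess u))

  right-balanced : Balanced (induced R Γ)
  right-balanced = Equivalence.from (right-balanced⇔ Γ σ isJoinSplitting)
    (λ v → subst (λ k → indeg Γ (R v) ≡ outdeg Γ (R v) + k) f≡a (right-deficit v))

ImbalancesCongruent⇒IsDirectedJoinOfBalanced : ∀ {n} (Γ : Digraph n) → Loopless Γ → ¬ Balanced Γ →
  ImbalancesCongruent Γ → IsDirectedJoinOfBalanced Γ
ImbalancesCongruent⇒IsDirectedJoinOfBalanced Γ loopless unbalanced congruent
  with ¬Balanced⇒∃excess Γ unbalanced | ¬Balanced⇒∃deficit Γ unbalanced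
     | partition (λ i → indeg Γ i < outdeg Γ i) (λ i → indeg Γ i <? outdeg Γ i)
... | i₀ , in<out₀ | j₀ , out<in₀ | a , b , σ , excessive , ¬excessive =
  a , b , induced (left σ) Γ , induced (right σ) Γ ,
  left-balanced , right-balanced , IsJoinSplitting⇒≅ Γ σ isJoinSplitting
  where
  left-excess : ∀ u → outdeg Γ (left σ u) ≡ indeg Γ (left σ u) + excess Γ i₀
  left-excess u = trans (outdeg≡indeg+excess Γ (<⇒≤ (excessive u)))
    (cong (_+_ (indeg Γ (left σ u))) (excess-unique Γ loopless congruent (<⇒≤ (excessive u)) (<⇒≤ in<out₀)))
  right-deficit : ∀ v → indeg Γ (right σ v) ≡ outdeg Γ (right σ v) + deficit Γ j₀
  right-deficit v = trans (indeg≡outdeg+deficit Γ (≮⇒≥ (¬excessive v)))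
    (cong (_+_ (outdeg Γ (right σ v))) (deficit-unique Γ loopless congruent (≮⇒≥ (¬excessive v)) (<⇒≤ out<in₀)))
  open ExcessSplitting Γ σ left-excess right-deficit (excess+deficit≡n Γ loopless congruent in<out₀ (<⇒≤ out<in₀))

lemma3p7 : (n : ℕ) (Γ : Digraph n) → Loopless Γ → ¬ Balanced Γ →
    (IsDirectedJoinOfBalanced Γ ⇔
      (∀ (i j : Fin n) → (+ n) ∣ (imbalance Γ i - imbalance Γ j)))
lemma3p7 n Γ loopless unbalanced = mk⇔
  (IsDirectedJoinOfBalanced⇒ImbalancesCongruent Γ)
  (ImbalancesCongruent⇒IsDirectedJoinOfBalanced Γ loopless unbalanced)
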